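{- Let $C$ be a set-multilinear circuit of size $s$ computing a degree-$d$ polynomial $P\in\mathbb{F}[X]$ with respect to $X=X_1\sqcup\dots\sqcup X_d$, and suppose the total number of distinct proof tree types of $C$ is $r$. Then there are set-multilinear circuits $C_1,\dots,C_r$, each of size at most $s$, such that $\sum_{i=1}^r C_i$ computes $P$ and, for each $i$, all proof trees of $C_i$ have the same proof tree type.
   Context: A set-multilinear circuit is an arithmetic circuit (inputs: variables or constants; $+$ gates, fan-in-2 $\times$ gates) with an index set $I_v\subseteq[d]$ per gate: a variable in $X_i$ has $\{i\}$, constants $\emptyset$, inputs of a $+$ gate share its index set, a $\times$ gate's index set is the disjoint union of its inputs', the output's is $[d]$. A proof tree is a subcircuit obtained from the output by keeping one input at each $+$ gate and both inputs at each $\times$ gate, with all inputs reached; ignoring constant leaves and contracting $+$ gates it is a binary tree with variable leaves and $\times$-gate internal nodes, and its proof tree type is that tree with each node $v$ labeled by its index set $I_v$. Size is the number of gates. -}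

module Defs where

open import Level using (Level; _⊔_)
open import Algebra.Bundles using (CommutativeRing)
open import Data.Nat using (ℕ; zero; suc)
open import Data.Fin using (Fin; zero; suc; _≟_)
open import Data.Fin.Subset using (Subset; ⁅_⁆; _∪_; _∩_) renaming (⊥ to ∅; ⊤ to full)
open import Data.List using (List; []; _∷_; map; foldr)
open import Data.List.Membership.Propositional using (_∈_)
open import Data.Maybe using (Maybe; just; nothing)
open import Data.Product using (Σ; _×_; _,_; ∃)
open import Data.Empty using (⊥)
open import Data.Bool using (if_then_else_)
open import Relation.Nullary using (¬_)
open import Relation.Nullary.Decidable using (⌊_⌋)
open import Relation.Binary.PropositionalEquality using (_≡_)
open import Function.Definitions using (Injective)

record IsField {c ℓ : Level} (F : CommutativeRing c ℓ) : Set (c ⊔ ℓ) where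
  open CommutativeRing F using (Carrier; _≈_; _+_; _*_; 0#; 1#)
  field
    nontrivial : ¬ (1# ≈ 0#)
    inverse    : ∀ x → ¬ (x ≈ 0#) → Σ Carrier λ y → (x * y) ≈ 1#

-- Circuits over the field F, with variables X = X_1 ⊔ ... ⊔ X_d where
-- X_i = { x_{i,j} | j : Fin (nv i) }.
module Circuits {c ℓ : Level} (F : CommutativeRing c ℓ) (d : ℕ) (nv : Fin d → ℕ) where
  open CommutativeRing F using (Carrier; _≈_; _+_; _*_; 0#; 1#)

  data Gate (A : Set) : Set c where
    var   : (i : Fin d) → Fin (nv i) → Gate A
    const : Carrier → Gate A
    add   : List A → Gate A
    mul   : A → A → Gate A

  mapGate : {A B : Set} → (A → B) → Gate A → Gate B
  mapGate f (var i j) = var i j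
  mapGate f (const a) = const a
  mapGate f (add l)   = add (map f l)
  mapGate f (mul a b) = mul (f a) (f b)

  -- A circuit with k gates, in topological order (a DAG): each new gate may only
  -- take as inputs gates already present. Gate zero is the most recently added one.
  data Circuit : ℕ → Set c where
    []  : Circuit 0
    _▷_ : {k : ℕ} → Circuit k → Gate (Fin k) → Circuit (suc k)

  gateAt : {k : ℕ} → Circuit k → Fin k → Gate (Fin k)
  gateAt (C ▷ g) zero    = mapGate suc g
  gateAt (C ▷ g) (suc v) = mapGate suc (gateAt C v)

  out : {n : ℕ} → Fin (suc n)
  out = zero

  Disjoint : Subset d → Subset d → Set
  Disjoint S T = (S ∩ T) ≡ ∅

  GateSM : {k : ℕ} → (Fin k → Subset d) → Subset d → Gate (Fin k) → Set
  GateSM I Iv (var i j) = Iv ≡ ⁅ i ⁆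
  GateSM I Iv (const a) = Iv ≡ ∅
  GateSM I Iv (add l)   = ∀ {u} → u ∈ l → I u ≡ Iv
  GateSM I Iv (mul a b) = Disjoint (I a) (I b) × (Iv ≡ (I a ∪ I b))

  IsSetMultilinear : {n : ℕ} → Circuit (suc n) → (Fin (suc n) → Subset d) → Set
  IsSetMultilinear C I = (∀ v → GateSM I (I v) (gateAt C v)) × (I out ≡ full)

  record SMCircuit : Set c where
    field
      n      : ℕ
      gates  : Circuit (suc n)
      label  : Fin (suc n) → Subset d
      isSM   : IsSetMultilinear gates label

  open SMCircuit public

  size : SMCircuit → ℕ
  size C = suc (n C)

  -- A set-multilinear monomial of degree d picks one
  -- variable from each X_i. A gate with index set I_v computes a set-multilinear
  -- polynomial on the parts in I_v; its coefficient of the monomial m restricted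
  -- to I_v is  coeffAt C v m  (this only depends on m restricted to I_v).
  Monomial : Set
  Monomial = (i : Fin d) → Fin (nv i)

  sumList : List Carrier → Carrier
  sumList = foldr _+_ 0#

  coeffGate : {k : ℕ} → (Fin k → Monomial → Carrier) → Gate (Fin k) → Monomial → Carrier
  coeffGate f (var i j) m = if ⌊ m i ≟ j ⌋ then 1# else 0#
  coeffGate f (const a) m = a
  coeffGate f (add l)   m = sumList (map (λ u → f u m) l)
  coeffGate f (mul a b) m = f a m * f b m

  coeffAt : {k : ℕ} → Circuit k → Fin k → Monomial → Carrier
  coeffAt (C ▷ g) zero    m = coeffGate (coeffAt C) g m
  coeffAt (C ▷ g) (suc v) m = coeffAt C v m

  -- The polynomial computed by C (its output gate has index set [d]),
  -- given by its coefficient on each degree-d set-multilinear monomial.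
  coeff : SMCircuit → Monomial → Carrier
  coeff C = coeffAt (gates C) out

  sumFin : (r : ℕ) → (Fin r → Carrier) → Carrier
  sumFin zero    f = 0#
  sumFin (suc r) f = f zero + sumFin r (λ i → f (suc i))

  data ProofTree {k : ℕ} (C : Circuit k) : Fin k → Set c where
    ptVar   : ∀ {v i j} → gateAt C v ≡ var i j → ProofTree C v
    ptConst : ∀ {v a} → gateAt C v ≡ const a → ProofTree C v
    ptAdd   : ∀ {v l u} → gateAt C v ≡ add l → u ∈ l → ProofTree C u → ProofTree C v
    ptMul   : ∀ {v a b} → gateAt C v ≡ mul a b → ProofTree C a → ProofTree C b → ProofTree C v

  -- Proof tree types: binary trees, leaves labelled {i} (stored as i),
  -- internal (×) nodes labelled by their index set; children ordered.
  data Shape : Set where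
    leaf : Fin d → Shape
    node : Subset d → Shape → Shape → Shape

  -- Type of a proof tree: constant leaves are dropped (nothing = no variable
  -- leaf left), + gates are contracted, and a × gate left with a single
  -- non-constant child is contracted as well.
  typeAt : {k : ℕ} {C : Circuit k} (I : Fin k → Subset d) {v : Fin k} →
           ProofTree C v → Maybe Shape
  typeAt I (ptVar {i = i} _)        = just (leaf i)
  typeAt I (ptConst _)              = nothing
  typeAt I (ptAdd _ _ t)            = typeAt I t
  typeAt I (ptMul {v = v} _ t₁ t₂) with typeAt I t₁ | typeAt I t₂
  ... | nothing | τ₂      = τ₂
  ... | just τ₁ | nothing = just τ₁
  ... | just τ₁ | just τ₂ = just (node (I v) τ₁ τ₂)

  PT : SMCircuit → Set c
  PT C = ProofTree (gates C) out

  type : (C : SMCircuit) → PT C → Maybe Shape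
  type C = typeAt (label C)

  NumProofTreeTypes : SMCircuit → ℕ → Set c
  NumProofTreeTypes C r =
    Σ (Fin r → Maybe Shape) λ e →
      Injective _≡_ _≡_ e
      × (∀ i → ∃ λ (t : PT C) → type C t ≡ e i)
      × (∀ (t : PT C) → ∃ λ i → type C t ≡ e i)

  SingleType : SMCircuit → Set c
  SingleType C = ∀ (t₁ t₂ : PT C) → type C t₁ ≡ type C t₂

-- For a type σ, the restriction of C to σ keeps a gate with index set X only if it is
-- consistent with the part σ ↾ X of σ at X, and replaces it by the empty sum otherwise.
-- It has the gates and index sets of C, and all its proof trees have type σ
-- (restrict-single). In a well-formed type the part at each index set is unique, so the
-- value of the restriction at a gate only depends on σ below that gate (restrict-local).
-- By induction on the circuit, every gate is the sum of its σ-parts over any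
-- duplicate-free cover of the types of its proof trees (decomposition): + gates exchange
-- two sums; × gates multiply the decompositions of their inputs, since types combine
-- injectively (mulType-injective) and types that are not realised contribute zero
-- (absent-part). The theorem is this decomposition at the output, over the r types.
module Submission where

open import Defs
open import Level using (Level)
open import Algebra.Bundles using (CommutativeRing)
open import Data.Nat using (ℕ; zero; suc; _≤_)
open import Data.Nat.Properties using (≤-refl)
open import Data.Fin using (Fin; zero; suc)
import Data.Fin as Fin
open import Data.Fin.Subset using (Subset; ⁅_⁆; _∪_; _∩_; _⊆_) renaming (⊥ to ∅; _∈_ to _∈ˢ_)
open import Data.Fin.Subset.Properties
  using ( ∉⊥; x∈⁅x⁆; x∈p∩q⁺; x∈p∪q⁺; p⊆p∪q; q⊆p∪q; ⊆-antisym; ⊆-min; ⊆-refl; ⊆-trans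
        ; ∪-identityˡ; ∪-identityʳ )
open import Data.Bool using () renaming (_≟_ to _≟ᵇ_)
open import Data.Maybe using (Maybe; just; nothing; _<∣>_)
import Data.Maybe.Properties as Maybeₚ
import Data.Vec.Properties as Vecₚ
open import Data.Unit using (⊤; tt)
open import Data.List using (List; []; _∷_; _++_; map; foldr; concatMap; cartesianProduct; deduplicate; tabulate)
open import Data.List.Properties using (map-∘; map-cong-local)
open import Data.List.Membership.Propositional using (_∈_; _∉_; find; lose)
open import Data.List.Membership.Propositional.Properties
  using ( ∈-map⁺; ∈-map⁻; ∈-concatMap⁺; ∈-concatMap⁻; ∈-deduplicate⁺; ∈-deduplicate⁻
        ; ∈-cartesianProduct⁺; ∈-cartesianProduct⁻; ∈-tabulate⁺; ∈-tabulate⁻ )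
open import Data.List.Relation.Unary.Any using (here; there; _─_)
open import Data.List.Relation.Unary.All as All using (All; []; _∷_)
open import Data.List.Relation.Unary.All.Properties using (─⁺; map⁺)
open import Data.List.Relation.Unary.AllPairs using ([]; _∷_)
open import Data.List.Relation.Unary.Unique.Propositional using (Unique)
open import Data.List.Relation.Unary.Unique.Propositional.Properties using (cartesianProduct⁺; tabulate⁺)
open import Data.List.Relation.Unary.Unique.DecPropositional.Properties using (deduplicate-!)
open import Data.Product using (Σ; ∃; _×_; _,_; proj₁; proj₂; uncurry)
open import Data.Sum using (_⊎_; inj₁; inj₂)
open import Data.Empty using (⊥; ⊥-elim)
open import Function.Definitions using (Injective)
open import Relation.Nullary using (¬_; Dec; yes; no)
open import Relation.Binary.Definitions using (DecidableEquality)
open import Relation.Binary.PropositionalEquality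
  using (_≡_; _≢_; refl; sym; trans; cong; cong₂; subst; module ≡-Reasoning)

module DuplicateFree {a} {A : Set a} where

  ∈-─⁺ : ∀ {x z : A} {ys} (p : x ∈ ys) → z ∈ ys → z ≢ x → z ∈ (ys ─ p)
  ∈-─⁺ (here refl) (here refl) z≢x = ⊥-elim (z≢x refl)
  ∈-─⁺ (here refl) (there q)   _   = q
  ∈-─⁺ (there p)   (here refl) _   = here refl
  ∈-─⁺ (there p)   (there q)   z≢x = there (∈-─⁺ p q z≢x)

  ∈-─⁻ : ∀ {x z : A} {ys} (p : x ∈ ys) → z ∈ (ys ─ p) → z ∈ ys
  ∈-─⁻ (here _)  q         = there q
  ∈-─⁻ (there p) (here e)  = here e
  ∈-─⁻ (there p) (there q) = there (∈-─⁻ p q)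

  unique-─ : ∀ {x : A} {ys} (p : x ∈ ys) → Unique ys → Unique (ys ─ p)
  unique-─ (here _)  (_ ∷ u) = u
  unique-─ (there p) (h ∷ u) = ─⁺ p h ∷ unique-─ p u

  ─-≢ : ∀ {x z : A} {ys} → Unique ys → (p : x ∈ ys) → z ∈ (ys ─ p) → z ≢ x
  ─-≢ (h ∷ _) (here refl) q           = λ z≡x → All.lookup h q (sym z≡x)
  ─-≢ (h ∷ _) (there p)   (here refl) = All.lookup h p
  ─-≢ (_ ∷ u) (there p)   (there q)   = ─-≢ u p q

  unique-map : ∀ {b} {B : Set b} (f : A → B) {xs} → (∀ {x y} → x ∈ xs → y ∈ xs → f x ≡ f y → x ≡ y) →
               Unique xs → Unique (map f xs)
  unique-map f {[]}     _   _       = []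
  unique-map f {x ∷ xs} inj (h ∷ u) =
    map⁺ (All.tabulate λ y∈xs fx≡fy → All.lookup h y∈xs (inj (here refl) (there y∈xs) fx≡fy))
    ∷ unique-map f (λ p q → inj (there p) (there q)) u

module ListSums {c ℓ} (R : CommutativeRing c ℓ) where
  open CommutativeRing R hiding (refl; sym; trans; reflexive)
  open CommutativeRing R using ()
    renaming (refl to ≈-refl; sym to ≈-sym; trans to ≈-trans; reflexive to ≈-reflexive)
  open import Algebra.Properties.CommutativeSemigroup +-commutativeSemigroup
    using (interchange; x∙yz≈y∙xz)
  open import Relation.Binary.Reasoning.Setoid setoid

  ∑ : ∀ {a} {A : Set a} → List A → (A → Carrier) → Carrier
  ∑ xs w = foldr _+_ 0# (map w xs)

  module _ {a} {A : Set a} where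

    ∑-cong : ∀ xs {w w′ : A → Carrier} → (∀ {x} → x ∈ xs → w x ≈ w′ x) → ∑ xs w ≈ ∑ xs w′
    ∑-cong []       _  = ≈-refl
    ∑-cong (x ∷ xs) eq = +-cong (eq (here refl)) (∑-cong xs (λ p → eq (there p)))

    ∑-zero : ∀ xs {w : A → Carrier} → (∀ {x} → x ∈ xs → w x ≈ 0#) → ∑ xs w ≈ 0#
    ∑-zero []       _  = ≈-refl
    ∑-zero (x ∷ xs) eq = ≈-trans (+-cong (eq (here refl)) (∑-zero xs (λ p → eq (there p)))) (+-identityˡ 0#)

    ∑-++ : ∀ xs ys (w : A → Carrier) → ∑ (xs ++ ys) w ≈ ∑ xs w + ∑ ys w
    ∑-++ []       ys w = ≈-sym (+-identityˡ _)
    ∑-++ (x ∷ xs) ys w = ≈-trans (+-congˡ (∑-++ xs ys w)) (≈-sym (+-assoc _ _ _))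

    ∑-+ : ∀ xs (u v : A → Carrier) → ∑ xs (λ x → u x + v x) ≈ ∑ xs u + ∑ xs v
    ∑-+ []       u v = ≈-sym (+-identityˡ 0#)
    ∑-+ (x ∷ xs) u v = ≈-trans (+-congˡ (∑-+ xs u v)) (interchange _ _ _ _)

    ∑-*ˡ : ∀ xs (w : A → Carrier) c → c * ∑ xs w ≈ ∑ xs (λ x → c * w x)
    ∑-*ˡ []       w c = zeroʳ c
    ∑-*ˡ (x ∷ xs) w c = ≈-trans (distribˡ c _ _) (+-congˡ (∑-*ˡ xs w c))

    ∑-*ʳ : ∀ xs (w : A → Carrier) c → ∑ xs w * c ≈ ∑ xs (λ x → w x * c)
    ∑-*ʳ []       w c = zeroˡ c
    ∑-*ʳ (x ∷ xs) w c = ≈-trans (distribʳ c _ _) (+-congˡ (∑-*ʳ xs w c))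

    ∑-map : ∀ {b} {B : Set b} (f : B → A) xs (w : A → Carrier) → ∑ (map f xs) w ≡ ∑ xs (λ x → w (f x))
    ∑-map f xs w = cong (foldr _+_ 0#) (sym (map-∘ xs))

    ∑-─ : ∀ {x ys} (p : x ∈ ys) (w : A → Carrier) → ∑ ys w ≈ w x + ∑ (ys ─ p) w
    ∑-─ (here refl) w = ≈-refl
    ∑-─ (there p)   w = ≈-trans (+-congˡ (∑-─ p w)) (x∙yz≈y∙xz _ _ _)

    ∑-⊆ : ∀ {xs ys} (w : A → Carrier) → Unique xs → Unique ys → (∀ {x} → x ∈ xs → x ∈ ys) →
          (∀ {y} → y ∈ ys → y ∉ xs → w y ≈ 0#) → ∑ xs w ≈ ∑ ys w
    ∑-⊆ {[]}     {ys} w _ _ _ vanish = ≈-sym (∑-zero ys (λ q → vanish q λ ()))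
    ∑-⊆ {x ∷ xs} {ys} w (x≢xs ∷ uxs) uys sub vanish = begin
      w x + ∑ xs w         ≈⟨ +-congˡ (∑-⊆ w uxs (unique-─ p uys) sub′ vanish′) ⟩
      w x + ∑ (ys ─ p) w   ≈⟨ ≈-sym (∑-─ p w) ⟩
      ∑ ys w               ∎
      where
      open DuplicateFree
      p = sub (here refl)
      sub′ : ∀ {z} → z ∈ xs → z ∈ (ys ─ p)
      sub′ q = ∈-─⁺ p (sub (there q)) (λ z≡x → All.lookup x≢xs q (sym z≡x))
      vanish′ : ∀ {y} → y ∈ (ys ─ p) → y ∉ xs → w y ≈ 0#
      vanish′ q y∉xs = vanish (∈-─⁻ p q) λ
        { (here y≡x) → ─-≢ uys p q y≡x
        ; (there q′) → y∉xs q′ }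

    ∑-single : ∀ {xs x} (w : A → Carrier) → Unique xs → x ∈ xs →
               (∀ {y} → y ∈ xs → y ≢ x → w y ≈ 0#) → ∑ xs w ≈ w x
    ∑-single w uxs x∈xs vanish = ≈-trans
      (≈-sym (∑-⊆ w ([] ∷ []) uxs (λ { (here refl) → x∈xs })
                  λ q y∉[x] → vanish q (λ y≡x → y∉[x] (here y≡x))))
      (+-identityʳ _)

  module _ {a b} {A : Set a} {B : Set b} where

    ∑-swap : ∀ xs ys (w : A → B → Carrier) → ∑ xs (λ x → ∑ ys (w x)) ≈ ∑ ys (λ y → ∑ xs (λ x → w x y))
    ∑-swap []       ys w = ≈-sym (∑-zero ys (λ _ → ≈-refl))
    ∑-swap (x ∷ xs) ys w = ≈-trans (+-congˡ (∑-swap xs ys w)) (≈-sym (∑-+ ys (w x) _))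

    ∑-product : ∀ xs ys (u : A → Carrier) (v : B → Carrier) →
                ∑ xs u * ∑ ys v ≈ ∑ xs (λ x → ∑ ys (λ y → u x * v y))
    ∑-product xs ys u v = ≈-trans (∑-*ʳ xs u _) (∑-cong xs (λ {x} _ → ∑-*ˡ ys v (u x)))

    ∑-cartesianProduct : ∀ xs ys (w : A × B → Carrier) →
                         ∑ (cartesianProduct xs ys) w ≈ ∑ xs (λ x → ∑ ys (λ y → w (x , y)))
    ∑-cartesianProduct []       ys w = ≈-refl
    ∑-cartesianProduct (x ∷ xs) ys w = begin
      ∑ (map (x ,_) ys ++ cartesianProduct xs ys) w
        ≈⟨ ∑-++ (map (x ,_) ys) _ w ⟩
      ∑ (map (x ,_) ys) w + ∑ (cartesianProduct xs ys) w
        ≈⟨ +-cong (≈-reflexive (∑-map (x ,_) ys w)) (∑-cartesianProduct xs ys w) ⟩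
      ∑ ys (λ y → w (x , y)) + ∑ xs (λ x → ∑ ys (λ y → w (x , y))) ∎

module ProofTreeTypes {c ℓ : Level} (F : CommutativeRing c ℓ) (d : ℕ) (nv : Fin d → ℕ) where
  open Circuits F d nv

  -- The type of a proof tree; nothing is the type of a tree with only constant leaves.
  TreeType : Set
  TreeType = Maybe Shape

  infix 4 _≟ˢ_ _≟ₛ_ _≟ₜ_
  infix 6 _↾_

  _≟ˢ_ : DecidableEquality (Subset d)
  _≟ˢ_ = Vecₚ.≡-dec _≟ᵇ_

  _≟ₛ_ : DecidableEquality Shape
  leaf i ≟ₛ leaf j with i Fin.≟ j
  ... | yes refl = yes refl
  ... | no i≢j   = no λ { refl → i≢j refl }
  leaf _ ≟ₛ node _ _ _ = no λ ()
  node _ _ _ ≟ₛ leaf _ = no λ ()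
  node S τ₁ τ₂ ≟ₛ node T σ₁ σ₂ with S ≟ˢ T | τ₁ ≟ₛ σ₁ | τ₂ ≟ₛ σ₂
  ... | yes refl | yes refl | yes refl = yes refl
  ... | no S≢T   | _        | _        = no λ { refl → S≢T refl }
  ... | yes _    | no ≢₁    | _        = no λ { refl → ≢₁ refl }
  ... | yes _    | yes _    | no ≢₂    = no λ { refl → ≢₂ refl }

  _≟ₜ_ : DecidableEquality TreeType
  _≟ₜ_ = Maybeₚ.≡-dec _≟ₛ_

  mulType : Subset d → TreeType → TreeType → TreeType
  mulType S nothing  σ₂       = σ₂
  mulType S (just τ) nothing  = just τ
  mulType S (just τ) (just υ) = just (node S τ υ)

  -- Well-formed types with index set S: each × node carries the disjoint union of the
  -- index sets of its children; these are exactly the types of set-multilinear trees.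
  data WfShape : Shape → Subset d → Set where
    leaf : ∀ {i S} → S ≡ ⁅ i ⁆ → WfShape (leaf i) S
    node : ∀ {S A B τ υ} → WfShape τ A → WfShape υ B → Disjoint A B → S ≡ A ∪ B →
           WfShape (node S τ υ) S

  Wf : TreeType → Subset d → Set
  Wf nothing  S = S ≡ ∅
  Wf (just τ) S = WfShape τ S

  subtree : Shape → Subset d → TreeType
  subtree (leaf i) X with X ≟ˢ ⁅ i ⁆
  ... | yes _ = just (leaf i)
  ... | no  _ = nothing
  subtree (node S τ υ) X with X ≟ˢ S
  ... | yes _ = just (node S τ υ)
  ... | no  _ = subtree τ X <∣> subtree υ X

  -- σ ↾ X: the part of the type σ sitting at index set X. In a set-multilinear circuit,
  -- a proof tree of type σ uses a gate with index set X only with a subtree of type σ ↾ X.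
  _↾_ : TreeType → Subset d → TreeType
  nothing ↾ X = nothing
  just τ  ↾ X = subtree τ X

  disjoint-∉ : ∀ {A B i} → Disjoint A B → i ∈ˢ A → i ∈ˢ B → ⊥
  disjoint-∉ A∩B≡∅ i∈A i∈B = ∉⊥ (subst (_ ∈ˢ_) A∩B≡∅ (x∈p∩q⁺ (i∈A , i∈B)))

  ∪-⊆ˡ : ∀ {S A B : Subset d} → S ≡ A ∪ B → A ⊆ S
  ∪-⊆ˡ refl = p⊆p∪q _

  ∪-⊆ʳ : ∀ {S A B : Subset d} → S ≡ A ∪ B → B ⊆ S
  ∪-⊆ʳ {A = A} refl = q⊆p∪q A _

  ⊆∅ : ∀ {X : Subset d} → X ⊆ ∅ → X ≡ ∅
  ⊆∅ {X} X⊆∅ = ⊆-antisym X⊆∅ (⊆-min X)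

  ∈∅-elim : ∀ {X : Subset d} {i} → X ≡ ∅ → i ∈ˢ X → ⊥
  ∈∅-elim refl = ∉⊥

  wf-nonempty : ∀ {τ S} → WfShape τ S → ∃ (_∈ˢ S)
  wf-nonempty (leaf {i} refl) = i , x∈⁅x⁆ i
  wf-nonempty (node w _ _ refl) with wf-nonempty w
  ... | i , i∈A = i , x∈p∪q⁺ (inj₁ i∈A)

  wf-∅ : ∀ {τ S} → WfShape τ S → S ≡ ∅ → ⊥
  wf-∅ w S≡∅ with wf-nonempty w
  ... | i , i∈S = ∈∅-elim S≡∅ i∈S

  wf-index : ∀ {τ S T} → WfShape τ S → WfShape τ T → S ≡ T
  wf-index (leaf S≡i)     (leaf T≡i)     = trans S≡i (sym T≡i)
  wf-index (node _ _ _ _) (node _ _ _ _) = refl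

  subtree-self : ∀ {τ S} → WfShape τ S → subtree τ S ≡ just τ
  subtree-self {leaf i} {S} (leaf S≡i) with S ≟ˢ ⁅ i ⁆
  ... | yes _   = refl
  ... | no S≢i  = ⊥-elim (S≢i S≡i)
  subtree-self {node S τ υ} (node _ _ _ _) with S ≟ˢ S
  ... | yes _   = refl
  ... | no S≢S  = ⊥-elim (S≢S refl)

  ↾-self : ∀ {σ S} → Wf σ S → σ ↾ S ≡ σ
  ↾-self {nothing} _ = refl
  ↾-self {just τ}  w = subtree-self w

  subtree-sound : ∀ {τ T X υ} → WfShape τ T → subtree τ X ≡ just υ → WfShape υ X × X ⊆ T
  subtree-sound {leaf i} {T} {X} (leaf T≡i) eq with X ≟ˢ ⁅ i ⁆
  subtree-sound (leaf T≡i) refl | yes X≡i = leaf X≡i , subst (_ ⊆_) (trans X≡i (sym T≡i)) ⊆-refl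
  subtree-sound (leaf T≡i) ()   | no _
  subtree-sound {node S τ υ} {X = X} w@(node wτ wυ _ refl) eq with X ≟ˢ S
  ... | yes refl with refl ← eq = w , ⊆-refl
  ... | no _ with subtree τ X in eqτ
  ...   | just _ with refl ← eq =
    let wx , X⊆A = subtree-sound wτ eqτ in wx , ⊆-trans X⊆A (p⊆p∪q _)
  ...   | nothing =
    let wx , X⊆B = subtree-sound wυ eq in wx , ⊆-trans X⊆B (q⊆p∪q _ _)

  subtree-absent : ∀ {τ T X} → WfShape τ T → (∀ {i} → i ∈ˢ X → i ∈ˢ T → ⊥) → subtree τ X ≡ nothing
  subtree-absent {τ} {X = X} w apart with subtree τ X in eq
  ... | nothing = refl
  ... | just υ with subtree-sound w eq
  ... | wυ , X⊆T with wf-nonempty wυ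
  ... | i , i∈X = ⊥-elim (apart i∈X (X⊆T i∈X))

  mulType-wf : ∀ {x y A B S} → Wf x A → Wf y B → Disjoint A B → S ≡ A ∪ B → Wf (mulType S x y) S
  mulType-wf {nothing} {nothing}        refl refl _  refl = ∪-identityˡ ∅
  mulType-wf {nothing} {just υ} {B = B} refl wy   _  refl = subst (WfShape υ) (sym (∪-identityˡ B)) wy
  mulType-wf {just τ} {nothing} {A = A} wx   refl _  refl = subst (WfShape τ) (sym (∪-identityʳ A)) wx
  mulType-wf {just τ} {just υ}          wx   wy   dj eq   = node wx wy dj eq

  mulType-↾ˡ : ∀ {x y A B S X} → Wf x A → Wf y B → Disjoint A B → S ≡ A ∪ B → X ⊆ A →
               mulType S x y ↾ X ≡ x ↾ X
  mulType-↾ˡ {nothing} {nothing} _  _  _ _ _ = refl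
  mulType-↾ˡ {nothing} {just υ}  wx wy _ _ X⊆A =
    subtree-absent wy λ i∈X _ → ∈∅-elim wx (X⊆A i∈X)
  mulType-↾ˡ {just τ}  {nothing} _  _  _ _ _ = refl
  mulType-↾ˡ {just τ}  {just υ} {S = S} {X} wx wy dj refl X⊆A with X ≟ˢ S
  ... | yes refl with wf-nonempty wy
  ...   | i , i∈B = ⊥-elim (disjoint-∉ dj (X⊆A (q⊆p∪q _ _ i∈B)) i∈B)
  mulType-↾ˡ {just τ}  {just υ} {S = S} {X} wx wy dj refl X⊆A | no _
    rewrite subtree-absent wy (λ i∈X i∈B → disjoint-∉ dj (X⊆A i∈X) i∈B) =
    Maybeₚ.<∣>-identityʳ (subtree τ X)

  mulType-↾ʳ : ∀ {x y A B S X} → Wf x A → Wf y B → Disjoint A B → S ≡ A ∪ B → X ⊆ B →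
               mulType S x y ↾ X ≡ y ↾ X
  mulType-↾ʳ {nothing}           _  _  _ _ _ = refl
  mulType-↾ʳ {just τ}  {nothing} wx wy _ _ X⊆B =
    subtree-absent wx λ i∈X _ → ∈∅-elim wy (X⊆B i∈X)
  mulType-↾ʳ {just τ}  {just υ} {S = S} {X} wx wy dj refl X⊆B with X ≟ˢ S
  ... | yes refl with wf-nonempty wx
  ...   | i , i∈A = ⊥-elim (disjoint-∉ dj i∈A (X⊆B (p⊆p∪q _ i∈A)))
  mulType-↾ʳ {just τ}  {just υ} {S = S} {X} wx wy dj refl X⊆B | no _
    rewrite subtree-absent wx (λ i∈X i∈A → disjoint-∉ dj i∈A (X⊆B i∈X)) = refl

  decompose : ∀ {σ A B S} → Wf σ S → S ≡ A ∪ B → Disjoint A B → σ ≡ mulType S (σ ↾ A) (σ ↾ B) →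
              Wf (σ ↾ A) A × Wf (σ ↾ B) B
  decompose {nothing} refl S≡A∪B _ _ = ⊆∅ (∪-⊆ˡ S≡A∪B) , ⊆∅ (∪-⊆ʳ S≡A∪B)
  decompose {just τ} {A} {B} w S≡A∪B dj σ≡ with subtree τ A in eA | subtree τ B in eB
  ... | just _  | just _  = proj₁ (subtree-sound w eA) , proj₁ (subtree-sound w eB)
  ... | nothing | nothing with () ← σ≡
  ... | nothing | just _ with refl ← σ≡ =
    let wB = proj₁ (subtree-sound w eB)
        A⊆B = λ {i} i∈A → subst (i ∈ˢ_) (wf-index w wB) (∪-⊆ˡ S≡A∪B i∈A)
    in ⊆∅ (λ i∈A → ⊥-elim (disjoint-∉ dj i∈A (A⊆B i∈A))) , wB
  ... | just _  | nothing with refl ← σ≡ =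
    let wA = proj₁ (subtree-sound w eA)
        B⊆A = λ {i} i∈B → subst (i ∈ˢ_) (wf-index w wA) (∪-⊆ʳ S≡A∪B i∈B)
    in wA , ⊆∅ (λ i∈B → ⊥-elim (disjoint-∉ dj (B⊆A i∈B) i∈B))

  mulType-injective : ∀ {x x′ y y′ A B S} → Wf x A → Wf x′ A → Wf y B → Wf y′ B →
                      mulType S x y ≡ mulType S x′ y′ → x ≡ x′ × y ≡ y′
  mulType-injective {nothing} {nothing}                      _  _   _  _   eq   = refl , eq
  mulType-injective {nothing} {just _}                       wx wx′ _  _   _    = ⊥-elim (wf-∅ wx′ wx)
  mulType-injective {just _}  {nothing}                      wx wx′ _  _   _    = ⊥-elim (wf-∅ wx wx′)
  mulType-injective {just _}  {just _} {nothing} {nothing}   _  _   _  _   refl = refl , refl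
  mulType-injective {just _}  {just _} {nothing} {just _}    _  _   wy wy′ _    = ⊥-elim (wf-∅ wy′ wy)
  mulType-injective {just _}  {just _} {just _}  {nothing}   _  _   wy wy′ _    = ⊥-elim (wf-∅ wy wy′)
  mulType-injective {just _}  {just _} {just _}  {just _}    _  _   _  _   refl = refl , refl

module CircuitBasics {c ℓ : Level} (F : CommutativeRing c ℓ) (d : ℕ) (nv : Fin d → ℕ) where
  open Circuits F d nv
  open ProofTreeTypes F d nv

  tail : ∀ {k} → (Fin (suc k) → Subset d) → Fin k → Subset d
  tail I v = I (suc v)

  record GatesSM {k} (C : Circuit k) (I : Fin k → Subset d) : Set where
    constructor gatesSM
    field gateSM : ∀ v → GateSM I (I v) (gateAt C v)
  open GatesSM public

  gateSM-lower : ∀ {k} (I : Fin (suc k) → Subset d) S (g : Gate (Fin k)) →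
                 GateSM I S (mapGate suc g) → GateSM (tail I) S g
  gateSM-lower I S (var i j) sm = sm
  gateSM-lower I S (const a) sm = sm
  gateSM-lower I S (add l)   sm = λ u∈l → sm (∈-map⁺ suc u∈l)
  gateSM-lower I S (mul a b) sm = sm

  sm-top : ∀ {k} {C : Circuit k} {g I} → GatesSM (C ▷ g) I → GateSM (tail I) (I zero) g
  sm-top {g = g} {I} sm = gateSM-lower I (I zero) g (gateSM sm zero)

  sm-tail : ∀ {k} {C : Circuit k} {g I} → GatesSM (C ▷ g) I → GatesSM C (tail I)
  sm-tail {C = C} {I = I} sm = gatesSM λ v → gateSM-lower I (I (suc v)) (gateAt C v) (gateSM sm (suc v))

  sm-at : ∀ {k} {C : Circuit k} {I v g} → GatesSM C I → gateAt C v ≡ g → GateSM I (I v) g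
  sm-at {I = I} {v} sm refl = gateSM sm v

  typeAt-mul : ∀ {k} {C : Circuit k} (I : Fin k → Subset d) {v a b} (p : gateAt C v ≡ mul a b) t₁ t₂ →
               typeAt {C = C} I (ptMul p t₁ t₂) ≡ mulType (I v) (typeAt I t₁) (typeAt I t₂)
  typeAt-mul I p t₁ t₂ with typeAt I t₁ | typeAt I t₂
  ... | nothing | _       = refl
  ... | just _  | nothing = refl
  ... | just _  | just _  = refl

  liftPT : ∀ {k} {C : Circuit k} {g v} → ProofTree C v → ProofTree (C ▷ g) (suc v)
  liftPT (ptVar p)       = ptVar (cong (mapGate suc) p)
  liftPT (ptConst p)     = ptConst (cong (mapGate suc) p)
  liftPT (ptAdd p u∈l t) = ptAdd (cong (mapGate suc) p) (∈-map⁺ suc u∈l) (liftPT t)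
  liftPT (ptMul p t₁ t₂) = ptMul (cong (mapGate suc) p) (liftPT t₁) (liftPT t₂)

  typeAt-lift : ∀ {k} {C : Circuit k} {g} (I : Fin (suc k) → Subset d) {v} (t : ProofTree C v) →
                typeAt I (liftPT {g = g} t) ≡ typeAt (tail I) t
  typeAt-lift I (ptVar p)       = refl
  typeAt-lift I (ptConst p)     = refl
  typeAt-lift I (ptAdd p u∈l t) = typeAt-lift I t
  typeAt-lift {C = C} {g} I {v} (ptMul p t₁ t₂) = begin
    typeAt I (ptMul (cong (mapGate suc) p) (liftPT t₁) (liftPT t₂))
      ≡⟨ typeAt-mul {C = C ▷ g} I {suc v} (cong (mapGate suc) p) (liftPT t₁) (liftPT t₂) ⟩
    mulType (I (suc v)) (typeAt I (liftPT t₁)) (typeAt I (liftPT t₂))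
      ≡⟨ cong₂ (mulType (I (suc v))) (typeAt-lift I t₁) (typeAt-lift I t₂) ⟩
    mulType (I (suc v)) (typeAt (tail I) t₁) (typeAt (tail I) t₂)
      ≡⟨ typeAt-mul {C = C} (tail I) p t₁ t₂ ⟨
    typeAt (tail I) (ptMul p t₁ t₂) ∎
    where open ≡-Reasoning

  typeAt-wf : ∀ {k} {C : Circuit k} {I v} → GatesSM C I → (t : ProofTree C v) → Wf (typeAt I t) (I v)
  typeAt-wf sm (ptVar p)   = leaf (sm-at sm p)
  typeAt-wf sm (ptConst p) = sm-at sm p
  typeAt-wf {I = I} sm (ptAdd p u∈l t) =
    subst (Wf (typeAt I t)) (sm-at sm p u∈l) (typeAt-wf sm t)
  typeAt-wf {C = C} {I} {v} sm (ptMul p t₁ t₂) with sm-at sm p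
  ... | dj , I≡ = subst (λ σ → Wf σ (I v)) (sym (typeAt-mul {C = C} I p t₁ t₂))
                        (mulType-wf (typeAt-wf sm t₁) (typeAt-wf sm t₂) dj I≡)

module Restriction {c ℓ : Level} (F : CommutativeRing c ℓ) (d : ℕ) (nv : Fin d → ℕ) where
  open Circuits F d nv
  open ProofTreeTypes F d nv
  open CircuitBasics F d nv
  open CommutativeRing F using (_*_)

  -- A target t assigns to every index set the type that the part of a proof tree at that
  -- index set should have. A gate with index set S is consistent with t when a proof tree
  -- through it can have, at S, the type prescribed by t given its inputs' prescribed types.
  Consistent : ∀ {k} → (Fin k → Subset d) → (Subset d → TreeType) → Subset d → Gate (Fin k) → Set
  Consistent I t S (var i j) = t S ≡ just (leaf i)
  Consistent I t S (const a) = t S ≡ nothing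
  Consistent I t S (add l)   = ⊤
  Consistent I t S (mul a b) = t S ≡ mulType S (t (I a)) (t (I b))

  consistent? : ∀ {k} I t S (g : Gate (Fin k)) → Dec (Consistent I t S g)
  consistent? I t S (var i j) = t S ≟ₜ just (leaf i)
  consistent? I t S (const a) = t S ≟ₜ nothing
  consistent? I t S (add l)   = yes tt
  consistent? I t S (mul a b) = t S ≟ₜ mulType S (t (I a)) (t (I b))

  keepIf : ∀ {P : Set} {A : Set} → Dec P → Gate A → Gate A
  keepIf (yes _) g = g
  keepIf (no _)  g = add []

  keepIf-yes : ∀ {P : Set} {A : Set} (p : Dec P) {g : Gate A} → P → keepIf p g ≡ g
  keepIf-yes (yes _) _ = refl
  keepIf-yes (no ¬x) x = ⊥-elim (¬x x)

  keepIf-no : ∀ {P : Set} {A : Set} (p : Dec P) {g : Gate A} → ¬ P → keepIf p g ≡ add []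
  keepIf-no (yes x) ¬x = ⊥-elim (¬x x)
  keepIf-no (no _)  _  = refl

  keepIf-inv : ∀ {P : Set} {A : Set} (p : Dec P) (g : Gate A) → (P × keepIf p g ≡ g) ⊎ keepIf p g ≡ add []
  keepIf-inv (yes x) g = inj₁ (x , refl)
  keepIf-inv (no _)  g = inj₂ refl

  keepIf-map : ∀ {P : Set} {A B : Set} (f : A → B) (p : Dec P) g →
               mapGate f (keepIf p g) ≡ keepIf p (mapGate f g)
  keepIf-map f (yes _) g = refl
  keepIf-map f (no _)  g = refl

  restrictGate : ∀ {k} → (Fin k → Subset d) → (Subset d → TreeType) → Subset d → Gate (Fin k) → Gate (Fin k)
  restrictGate I t S g = keepIf (consistent? I t S g) g

  -- The restriction of C to target t: every gate inconsistent with t is zeroed out.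
  -- It has the same gates (hence the same size) and the same index sets as C.
  restrict : ∀ {k} → Circuit k → (Fin k → Subset d) → (Subset d → TreeType) → Circuit k
  restrict []      I t = []
  restrict (C ▷ g) I t = restrict C (tail I) t ▷ restrictGate (tail I) t (I zero) g

  restrictGate-lift : ∀ {k} (I : Fin (suc k) → Subset d) t S (g : Gate (Fin k)) →
                      mapGate suc (restrictGate (tail I) t S g) ≡ restrictGate I t S (mapGate suc g)
  restrictGate-lift I t S g@(var _ _) = keepIf-map suc (consistent? (tail I) t S g) g
  restrictGate-lift I t S g@(const _) = keepIf-map suc (consistent? (tail I) t S g) g
  restrictGate-lift I t S (add l)     = refl
  restrictGate-lift I t S g@(mul _ _) = keepIf-map suc (consistent? (tail I) t S g) g

  gateAt-restrict : ∀ {k} (C : Circuit k) I t v →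
                    gateAt (restrict C I t) v ≡ restrictGate I t (I v) (gateAt C v)
  gateAt-restrict (C ▷ g) I t zero    = restrictGate-lift I t (I zero) g
  gateAt-restrict (C ▷ g) I t (suc v) =
    trans (cong (mapGate suc) (gateAt-restrict C (tail I) t v)) (restrictGate-lift I t (I (suc v)) (gateAt C v))

  -- The restriction is set-multilinear with the same labelling (zeroed gates are empty sums).
  restrict-sm : ∀ {k} {C : Circuit k} {I} t → GatesSM C I → GatesSM (restrict C I t) I
  restrict-sm {C = C} {I} t sm = gatesSM restricted
    where
    restricted : ∀ v → GateSM I (I v) (gateAt (restrict C I t) v)
    restricted v with keepIf-inv (consistent? I t (I v) (gateAt C v)) (gateAt C v)
    ... | inj₁ (_ , kept) = subst (GateSM I (I v)) (sym (trans (gateAt-restrict C I t v) kept)) (gateSM sm v)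
    ... | inj₂ zeroed     = subst (GateSM I (I v)) (sym (trans (gateAt-restrict C I t v) zeroed)) λ ()

  restricted-gate : ∀ {k} (C : Circuit k) I t {v g} → gateAt (restrict C I t) v ≡ g →
                    (Consistent I t (I v) g × gateAt C v ≡ g) ⊎ g ≡ add []
  restricted-gate C I t {v} refl with keepIf-inv (consistent? I t (I v) (gateAt C v)) (gateAt C v)
  ... | inj₁ (c , kept) = inj₁ (subst (Consistent I t (I v)) (sym kept′) c , sym kept′)
    where kept′ = trans (gateAt-restrict C I t v) kept
  ... | inj₂ zeroed     = inj₂ (trans (gateAt-restrict C I t v) zeroed)

  restrict-single : ∀ {k} (C : Circuit k) I t → GatesSM C I → ∀ {v} (p : ProofTree (restrict C I t) v) →
                    typeAt I p ≡ t (I v)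
  restrict-single C I t sm (ptVar q) with restricted-gate C I t q
  ... | inj₁ (c , _) = sym c
  ... | inj₂ ()
  restrict-single C I t sm (ptConst q) with restricted-gate C I t q
  ... | inj₁ (c , _) = sym c
  ... | inj₂ ()
  restrict-single C I t sm (ptAdd q u∈l p) with restricted-gate C I t q
  ... | inj₁ (_ , g≡) = trans (restrict-single C I t sm p) (cong t (sm-at sm g≡ u∈l))
  ... | inj₂ refl with () ← u∈l
  restrict-single C I t sm {v} (ptMul q p₁ p₂) with restricted-gate C I t q
  ... | inj₁ (c , _) = begin
    typeAt I (ptMul q p₁ p₂)                      ≡⟨ typeAt-mul {C = restrict C I t} I q p₁ p₂ ⟩
    mulType (I v) (typeAt I p₁) (typeAt I p₂)     ≡⟨ cong₂ (mulType (I v)) (restrict-single C I t sm p₁)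
                                                                         (restrict-single C I t sm p₂) ⟩
    mulType (I v) (t (I _)) (t (I _))             ≡⟨ c ⟨
    t (I v)                                       ∎
    where open ≡-Reasoning
  ... | inj₂ ()

  restrictGate-local : ∀ {k} (I : Fin k → Subset d) {t t′ : Subset d → TreeType} S (g : Gate (Fin k)) →
                       GateSM I S g → (∀ X → X ⊆ S → t X ≡ t′ X) →
                       restrictGate I t S g ≡ restrictGate I t′ S g
  restrictGate-local I S (var i j) _ agree =
    cong (λ σ → keepIf (σ ≟ₜ just (leaf i)) (var i j)) (agree S ⊆-refl)
  restrictGate-local I S (const a) _ agree =
    cong (λ σ → keepIf (σ ≟ₜ nothing) (const a)) (agree S ⊆-refl)
  restrictGate-local I S (add l)   _ agree = refl
  restrictGate-local I S (mul a b) (_ , S≡) agree =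
    cong₂ (λ σ τ → keepIf (σ ≟ₜ τ) (mul a b)) (agree S ⊆-refl)
          (cong₂ (mulType S) (agree (I a) (∪-⊆ˡ S≡)) (agree (I b) (∪-⊆ʳ S≡)))

  restrict-local : ∀ {k} (C : Circuit k) I → GatesSM C I → ∀ {t t′} v →
                   (∀ X → X ⊆ I v → t X ≡ t′ X) → ∀ m →
                   coeffAt (restrict C I t) v m ≡ coeffAt (restrict C I t′) v m
  restrict-local (C ▷ g) I sm {t} {t′} zero agree m = begin
    coeffGate (coeffAt (restrict C I′ t)) (restrictGate I′ t S g) m
      ≡⟨ cong (λ h → coeffGate f h m) (restrictGate-local I′ S g (sm-top sm) agree) ⟩
    coeffGate (coeffAt (restrict C I′ t)) (restrictGate I′ t′ S g) m
      ≡⟨ keepIf-value (consistent? I′ t′ S g) (inputs-agree g (sm-top sm)) ⟩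
    coeffGate (coeffAt (restrict C I′ t′)) (restrictGate I′ t′ S g) m ∎
    where
    open ≡-Reasoning
    I′ = tail I
    S  = I zero
    f  = coeffAt (restrict C I′ t)
    f′ = coeffAt (restrict C I′ t′)
    inputs-agree : ∀ g → GateSM I′ S g → coeffGate f g m ≡ coeffGate f′ g m
    inputs-agree (var i j) _        = refl
    inputs-agree (const a) _        = refl
    inputs-agree (add l)   same     = cong sumList (map-cong-local (All.tabulate λ {u} u∈l →
      restrict-local C I′ (sm-tail sm) u (λ X X⊆ → agree X (subst (X ⊆_) (same u∈l) X⊆)) m))
    inputs-agree (mul a b) (_ , S≡) = cong₂ _*_
      (restrict-local C I′ (sm-tail sm) a (λ X X⊆A → agree X (⊆-trans X⊆A (∪-⊆ˡ S≡))) m)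
      (restrict-local C I′ (sm-tail sm) b (λ X X⊆B → agree X (⊆-trans X⊆B (∪-⊆ʳ S≡))) m)
    keepIf-value : ∀ {P : Set} (p : Dec P) {g} → coeffGate f g m ≡ coeffGate f′ g m →
                   coeffGate f (keepIf p g) m ≡ coeffGate f′ (keepIf p g) m
    keepIf-value (yes _) same = same
    keepIf-value (no _)  _    = refl
  restrict-local (C ▷ g) I sm (suc v) agree m = restrict-local C (tail I) (sm-tail sm) v agree m

module GateTypes {c ℓ : Level} (F : CommutativeRing c ℓ) (d : ℕ) (nv : Fin d → ℕ) where
  open Circuits F d nv
  open ProofTreeTypes F d nv
  open CircuitBasics F d nv
  open DuplicateFree using (unique-map)

  gateTypes : ∀ {k} → (Fin k → List TreeType) → Subset d → Gate (Fin k) → List TreeType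
  gateTypes T S (var i j) = just (leaf i) ∷ []
  gateTypes T S (const a) = nothing ∷ []
  gateTypes T S (add l)   = deduplicate _≟ₜ_ (concatMap T l)
  gateTypes T S (mul a b) = map (uncurry (mulType S)) (cartesianProduct (T a) (T b))

  types : ∀ {k} → Circuit k → (Fin k → Subset d) → Fin k → List TreeType
  types (C ▷ g) I zero    = gateTypes (types C (tail I)) (I zero) g
  types (C ▷ g) I (suc v) = types C (tail I) v

  realize : ∀ {k} (C : Circuit k) I v {σ} → σ ∈ types C I v → Σ (ProofTree C v) λ p → typeAt I p ≡ σ
  realize (C ▷ var i j) I zero (here refl) = ptVar refl , refl
  realize (C ▷ const a) I zero (here refl) = ptConst refl , refl
  realize (C ▷ add l)   I zero σ∈
    with u , u∈l , σ∈u ← find (∈-concatMap⁻ (types C (tail I)) (∈-deduplicate⁻ _≟ₜ_ _ σ∈))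
    with p , p≡σ ← realize C (tail I) u σ∈u
    = ptAdd refl (∈-map⁺ suc u∈l) (liftPT p) , trans (typeAt-lift I p) p≡σ
  realize (C ▷ mul a b) I zero σ∈
    with (x , y) , xy∈ , refl ← ∈-map⁻ (uncurry (mulType (I zero))) σ∈
    with x∈ , y∈ ← ∈-cartesianProduct⁻ (types C (tail I) a) (types C (tail I) b) xy∈
    with p , refl ← realize C (tail I) a x∈
    with q , refl ← realize C (tail I) b y∈
    = ptMul refl (liftPT p) (liftPT q) ,
      trans (typeAt-mul {C = C ▷ mul a b} I refl (liftPT p) (liftPT q))
            (cong₂ (mulType (I zero)) (typeAt-lift I p) (typeAt-lift I q))
  realize (C ▷ g) I (suc v) σ∈ with p , p≡σ ← realize C (tail I) v σ∈
    = liftPT p , trans (typeAt-lift I p) p≡σ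

  types-wf : ∀ {k} {C : Circuit k} {I v σ} → GatesSM C I → σ ∈ types C I v → Wf σ (I v)
  types-wf {C = C} {I} {v} sm σ∈ with p , refl ← realize C I v σ∈ = typeAt-wf sm p

  types-unique : ∀ {k} (C : Circuit k) I → GatesSM C I → ∀ v → Unique (types C I v)
  types-unique (C ▷ var i j) I sm zero = [] ∷ []
  types-unique (C ▷ const a) I sm zero = [] ∷ []
  types-unique (C ▷ add l)   I sm zero = deduplicate-! _≟ₜ_ (concatMap (types C (tail I)) l)
  types-unique (C ▷ mul a b) I sm zero =
    unique-map (uncurry (mulType (I zero))) injective
      (cartesianProduct⁺ (types-unique C (tail I) sm′ a) (types-unique C (tail I) sm′ b))
    where
    sm′ = sm-tail sm
    Ta = types C (tail I) a
    Tb = types C (tail I) b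
    injective : ∀ {xy xy′} → xy ∈ cartesianProduct Ta Tb → xy′ ∈ cartesianProduct Ta Tb →
                uncurry (mulType (I zero)) xy ≡ uncurry (mulType (I zero)) xy′ → xy ≡ xy′
    injective {x , y} {x′ , y′} xy∈ xy′∈ eq
      with x∈ , y∈ ← ∈-cartesianProduct⁻ Ta Tb xy∈
      with x′∈ , y′∈ ← ∈-cartesianProduct⁻ Ta Tb xy′∈
      with refl , refl ← mulType-injective (types-wf sm′ x∈) (types-wf sm′ x′∈)
                                           (types-wf sm′ y∈) (types-wf sm′ y′∈) eq
      = refl
  types-unique (C ▷ g) I sm (suc v) = types-unique C (tail I) (sm-tail sm) v

module Decomposition {c ℓ : Level} (F : CommutativeRing c ℓ) (d : ℕ) (nv : Fin d → ℕ) where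
  open Circuits F d nv
  open ProofTreeTypes F d nv
  open CircuitBasics F d nv
  open Restriction F d nv
  open GateTypes F d nv
  open ListSums F
  open CommutativeRing F using (Carrier; _≈_; _+_; _*_; 0#; +-group)
  module Rg = CommutativeRing F
  open import Algebra.Properties.Group +-group using () renaming (identityˡ-unique to +-identityˡ-unique)
  open import Data.List.Membership.DecPropositional _≟ₜ_ using (_∈?_)

  part : ∀ {k} → Circuit k → (Fin k → Subset d) → TreeType → Fin k → Monomial → Carrier
  part C I σ v m = coeffAt (restrict C I (σ ↾_)) v m

  record TypeCover {k} (C : Circuit k) (I : Fin k → Subset d) (v : Fin k) (L : List TreeType) : Set where
    field
      unique   : Unique L
      wf       : ∀ {σ} → σ ∈ L → Wf σ (I v)
      complete : ∀ {σ} → σ ∈ types C I v → σ ∈ L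

  types-cover : ∀ {k} {C : Circuit k} {I} → GatesSM C I → ∀ v → TypeCover C I v (types C I v)
  types-cover {C = C} {I} sm v = record
    { unique = types-unique C I sm v ; wf = types-wf sm ; complete = λ σ∈ → σ∈ }

  cover-tail : ∀ {k} {C : Circuit k} {g I v L} → TypeCover (C ▷ g) I (suc v) L → TypeCover C (tail I) v L
  cover-tail cover = record { unique = unique ; wf = wf ; complete = complete }
    where open TypeCover cover

  Decomposes : ∀ {k} → Circuit k → (Fin k → Subset d) → Fin k → Set ℓ
  Decomposes C I v = ∀ {L} → TypeCover C I v L → ∀ m → coeffAt C v m ≈ ∑ L (λ σ → part C I σ v m)

  -- A well-formed type that is not the type of any proof tree at v has a zero part there:
  -- compare the decompositions over the types at v with and without it.
  absent-part : ∀ {k} {C : Circuit k} {I v x} → GatesSM C I → Decomposes C I v →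
                Wf x (I v) → x ∉ types C I v → ∀ m → part C I x v m ≈ 0#
  absent-part {C = C} {I} {v} {x} sm decomposes wx x∉ m =
    +-identityˡ-unique (part C I x v m) (∑ (types C I v) (λ σ → part C I σ v m))
      (Rg.trans (Rg.sym (decomposes with-x m)) (decomposes (types-cover sm v) m))
    where
    open TypeCover (types-cover sm v)
    with-x : TypeCover C I v (x ∷ types C I v)
    with-x = record
      { unique   = All.tabulate (λ σ∈ x≡σ → x∉ (subst (_∈ types C I v) (sym x≡σ) σ∈)) ∷ unique
      ; wf       = λ { (here refl) → wx ; (there σ∈) → wf σ∈ }
      ; complete = there }

  -- Variable and constant gates: only their own type τ₀ contributes.
  decompose-atomic : ∀ {k} {C : Circuit k} {I L} (g : Gate (Fin k)) τ₀ →
    (∀ (f f′ : Fin k → Monomial → Carrier) m → coeffGate f g m ≡ coeffGate f′ g m) →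
    (∀ t → restrictGate (tail I) t (I zero) g ≡ keepIf (t (I zero) ≟ₜ τ₀) g) →
    TypeCover (C ▷ g) I zero L → τ₀ ∈ L →
    ∀ m → coeffAt (C ▷ g) zero m ≈ ∑ L (λ σ → part (C ▷ g) I σ zero m)
  decompose-atomic {C = C} {I} {L} g τ₀ constant kept cover τ₀∈ m = begin
    coeffGate (coeffAt C) g m
      ≡⟨ constant (coeffAt C) (f τ₀) m ⟩
    coeffGate (f τ₀) g m
      ≡⟨ cong (λ h → coeffGate (f τ₀) h m) (keepIf-yes (τ₀ ≟ₜ τ₀) refl) ⟨
    coeffGate (f τ₀) (keepIf (τ₀ ≟ₜ τ₀) g) m
      ≡⟨ value τ₀∈ ⟨
    w τ₀
      ≈⟨ ∑-single w unique τ₀∈ others-vanish ⟨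
    ∑ L w ∎
    where
    open import Relation.Binary.Reasoning.Setoid Rg.setoid
    open TypeCover cover
    f : TreeType → Fin _ → Monomial → Carrier
    f σ = coeffAt (restrict C (tail I) (σ ↾_))
    w : TreeType → Carrier
    w σ = part (C ▷ g) I σ zero m
    value : ∀ {σ} → σ ∈ L → w σ ≡ coeffGate (f σ) (keepIf (σ ≟ₜ τ₀) g) m
    value {σ} σ∈ = cong (λ h → coeffGate (f σ) h m)
      (trans (kept (σ ↾_)) (cong (λ σ′ → keepIf (σ′ ≟ₜ τ₀) g) (↾-self (wf σ∈))))
    others-vanish : ∀ {σ} → σ ∈ L → σ ≢ τ₀ → w σ ≈ 0#
    others-vanish {σ} σ∈ σ≢τ₀ =
      Rg.reflexive (trans (value σ∈) (cong (λ h → coeffGate (f σ) h m) (keepIf-no (σ ≟ₜ τ₀) σ≢τ₀)))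

  -- + gates: decompose every input over the same cover and exchange the two sums.
  decompose-add : ∀ {k} {C : Circuit k} {I} l → GateSM (tail I) (I zero) (add l) →
                  (∀ u → Decomposes C (tail I) u) → Decomposes (C ▷ add l) I zero
  decompose-add {C = C} {I} l same decomposes {L} cover m = begin
    ∑ l (λ u → coeffAt C u m)
      ≈⟨ ∑-cong l (λ u∈l → decomposes _ (cover-input u∈l) m) ⟩
    ∑ l (λ u → ∑ L (λ σ → part C (tail I) σ u m))
      ≈⟨ ∑-swap l L (λ u σ → part C (tail I) σ u m) ⟩
    ∑ L (λ σ → ∑ l (λ u → part C (tail I) σ u m)) ∎
    where
    open import Relation.Binary.Reasoning.Setoid Rg.setoid
    open TypeCover cover
    cover-input : ∀ {u} → u ∈ l → TypeCover C (tail I) u L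
    cover-input u∈l = record
      { unique   = unique
      ; wf       = λ σ∈ → subst (Wf _) (sym (same u∈l)) (wf σ∈)
      ; complete = λ σ∈ → complete (∈-deduplicate⁺ _≟ₜ_ (∈-concatMap⁺ (types C (tail I)) (lose u∈l σ∈)))
      }

  mul-part : ∀ {k} {C : Circuit k} {I a b x y} → GatesSM (C ▷ mul a b) I →
             Wf x (tail I a) → Wf y (tail I b) → ∀ m →
             part (C ▷ mul a b) I (mulType (I zero) x y) zero m ≡ part C (tail I) x a m * part C (tail I) y b m
  mul-part {C = C} {I} {a} {b} {x} {y} sm wx wy m = begin
    coeffGate (f σ) (restrictGate (tail I) (σ ↾_) S (mul a b)) m
      ≡⟨ cong (λ h → coeffGate (f σ) h m) (keepIf-yes (consistent? (tail I) (σ ↾_) S (mul a b)) consistent) ⟩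
    f σ a m * f σ b m
      ≡⟨ cong₂ _*_ (restrict-local C (tail I) sm′ a (λ X X⊆A → mulType-↾ˡ wx wy dj S≡ X⊆A) m)
                   (restrict-local C (tail I) sm′ b (λ X X⊆B → mulType-↾ʳ wx wy dj S≡ X⊆B) m) ⟩
    f x a m * f y b m ∎
    where
    open ≡-Reasoning
    sm′ = sm-tail sm
    S = I zero
    σ = mulType S x y
    f : TreeType → Fin _ → Monomial → Carrier
    f τ = coeffAt (restrict C (tail I) (τ ↾_))
    dj = proj₁ (sm-top sm)
    S≡ = proj₂ (sm-top sm)
    consistent : σ ↾ S ≡ mulType S (σ ↾ tail I a) (σ ↾ tail I b)
    consistent = trans (↾-self (mulType-wf wx wy dj S≡))
      (sym (cong₂ (mulType S) (trans (mulType-↾ˡ wx wy dj S≡ ⊆-refl) (↾-self wx))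
                              (trans (mulType-↾ʳ wx wy dj S≡ ⊆-refl) (↾-self wy))))

  -- A × gate has a zero part for every well-formed type that is not the type of one of
  -- its proof trees: such a type is not a combination of types of proof trees at the inputs.
  mul-part-absent : ∀ {k} {C : Circuit k} {I a b σ} → GatesSM (C ▷ mul a b) I →
                    (∀ u → Decomposes C (tail I) u) → Wf σ (I zero) → σ ∉ types (C ▷ mul a b) I zero →
                    ∀ m → part (C ▷ mul a b) I σ zero m ≈ 0#
  mul-part-absent {C = C} {I} {a} {b} {σ} sm decomposes wσ σ∉ m
    with keepIf-inv (consistent? (tail I) (σ ↾_) (I zero) (mul a b)) (mul a b)
  ... | inj₂ zeroed =
    Rg.reflexive (cong (λ h → coeffGate (coeffAt (restrict C (tail I) (σ ↾_))) h m) zeroed)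
  ... | inj₁ (consistent , kept) = Rg.trans (Rg.reflexive (cong (λ h → coeffGate (f σ) h m) kept)) vanishes
    where
    sm′ = sm-tail sm
    S = I zero
    A = tail I a
    B = tail I b
    dj = proj₁ (sm-top sm)
    S≡ = proj₂ (sm-top sm)
    f : TreeType → Fin _ → Monomial → Carrier
    f τ = coeffAt (restrict C (tail I) (τ ↾_))
    σ≡ : σ ≡ mulType S (σ ↾ A) (σ ↾ B)
    σ≡ = trans (sym (↾-self wσ)) consistent
    wA = proj₁ (decompose wσ S≡ dj σ≡)
    wB = proj₂ (decompose wσ S≡ dj σ≡)
    -- below the inputs, σ agrees with its parts at A and at B, which vanish if not realised
    left-vanishes : σ ↾ A ∉ types C (tail I) a → f σ a m ≈ 0#
    left-vanishes σA∉ = Rg.trans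
      (Rg.reflexive (restrict-local C (tail I) sm′ a
        (λ X X⊆A → trans (cong (_↾ X) σ≡) (mulType-↾ˡ wA wB dj S≡ X⊆A)) m))
      (absent-part sm′ (decomposes a) wA σA∉ m)
    right-vanishes : σ ↾ B ∉ types C (tail I) b → f σ b m ≈ 0#
    right-vanishes σB∉ = Rg.trans
      (Rg.reflexive (restrict-local C (tail I) sm′ b
        (λ X X⊆B → trans (cong (_↾ X) σ≡) (mulType-↾ʳ wA wB dj S≡ X⊆B)) m))
      (absent-part sm′ (decomposes b) wB σB∉ m)
    vanishes : f σ a m * f σ b m ≈ 0#
    vanishes with (σ ↾ A) ∈? types C (tail I) a | (σ ↾ B) ∈? types C (tail I) b
    ... | no σA∉ | _      = Rg.trans (Rg.*-congʳ (left-vanishes σA∉)) (Rg.zeroˡ _)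
    ... | yes _  | no σB∉ = Rg.trans (Rg.*-congˡ (right-vanishes σB∉)) (Rg.zeroʳ _)
    ... | yes σA∈ | yes σB∈ = ⊥-elim (σ∉ (subst (_∈ types (C ▷ mul a b) I zero) (sym σ≡)
                                           (∈-map⁺ (uncurry (mulType S)) (∈-cartesianProduct⁺ σA∈ σB∈))))

  -- × gates: multiply the decompositions of the inputs over their types; the combined
  -- types are exactly the types at the gate, and all other types of the cover vanish.
  decompose-mul : ∀ {k} {C : Circuit k} {I} a b → GatesSM (C ▷ mul a b) I →
                  (∀ u → Decomposes C (tail I) u) → Decomposes (C ▷ mul a b) I zero
  decompose-mul {C = C} {I} a b sm decomposes {L} cover m = begin
    coeffAt C a m * coeffAt C b m
      ≈⟨ Rg.*-cong (decomposes a (types-cover sm′ a) m) (decomposes b (types-cover sm′ b) m) ⟩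
    ∑ Ta (λ x → part C (tail I) x a m) * ∑ Tb (λ y → part C (tail I) y b m)
      ≈⟨ ∑-product Ta Tb _ _ ⟩
    ∑ Ta (λ x → ∑ Tb (λ y → part C (tail I) x a m * part C (tail I) y b m))
      ≈⟨ ∑-cong Ta (λ x∈ → ∑-cong Tb (λ y∈ →
           Rg.reflexive (mul-part sm (types-wf sm′ x∈) (types-wf sm′ y∈) m))) ⟨
    ∑ Ta (λ x → ∑ Tb (λ y → w (mulType S x y)))
      ≈⟨ ∑-cartesianProduct Ta Tb (λ xy → w (uncurry (mulType S) xy)) ⟨
    ∑ (cartesianProduct Ta Tb) (λ xy → w (uncurry (mulType S) xy))
      ≡⟨ ∑-map (uncurry (mulType S)) (cartesianProduct Ta Tb) w ⟨
    ∑ (types (C ▷ mul a b) I zero) w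
      ≈⟨ ∑-⊆ w (types-unique (C ▷ mul a b) I sm zero) unique complete
              (λ σ∈ σ∉ → mul-part-absent sm decomposes (wf σ∈) σ∉ m) ⟩
    ∑ L w ∎
    where
    open import Relation.Binary.Reasoning.Setoid Rg.setoid
    open TypeCover cover
    sm′ = sm-tail sm
    S = I zero
    Ta = types C (tail I) a
    Tb = types C (tail I) b
    w : TreeType → Carrier
    w σ = part (C ▷ mul a b) I σ zero m

  decomposition : ∀ {k} (C : Circuit k) I → GatesSM C I → ∀ v → Decomposes C I v
  decomposition (C ▷ var i j) I sm zero cover = decompose-atomic (var i j) (just (leaf i))
    (λ _ _ _ → refl) (λ _ → refl) cover (TypeCover.complete cover (here refl))
  decomposition (C ▷ const a) I sm zero cover = decompose-atomic (const a) nothing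
    (λ _ _ _ → refl) (λ _ → refl) cover (TypeCover.complete cover (here refl))
  decomposition (C ▷ add l) I sm zero =
    decompose-add l (sm-top sm) (decomposition C (tail I) (sm-tail sm))
  decomposition (C ▷ mul a b) I sm zero =
    decompose-mul a b sm (decomposition C (tail I) (sm-tail sm))
  decomposition (C ▷ g) I sm (suc v) cover =
    decomposition C (tail I) (sm-tail sm) v (cover-tail cover)

  enumeration-cover : ∀ {k r} {C : Circuit k} {I v} (e : Fin r → TreeType) → GatesSM C I →
                      Injective _≡_ _≡_ e →
                      (∀ i → ∃ λ (p : ProofTree C v) → typeAt I p ≡ e i) →
                      (∀ (p : ProofTree C v) → ∃ λ i → typeAt I p ≡ e i) → TypeCover C I v (tabulate e)
  enumeration-cover {C = C} {I} {v} e sm injective realized covers = record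
    { unique   = tabulate⁺ injective
    ; wf       = λ σ∈ → let i , σ≡ = ∈-tabulate⁻ σ∈ ; p , p≡ = realized i
                        in subst (λ σ → Wf σ (I v)) (trans p≡ (sym σ≡)) (typeAt-wf sm p)
    ; complete = λ σ∈ → let p , p≡σ = realize C I v σ∈ ; i , p≡ = covers p
                        in subst (_∈ tabulate e) (trans (sym p≡) p≡σ) (∈-tabulate⁺ i) }

  sumFin-tabulate : ∀ r (e : Fin r → TreeType) (w : TreeType → Carrier) →
                    sumFin r (λ i → w (e i)) ≡ ∑ (tabulate e) w
  sumFin-tabulate zero    e w = refl
  sumFin-tabulate (suc r) e w = cong (w (e zero) +_) (sumFin-tabulate r (λ i → e (suc i)) w)

  sum-of-parts : ∀ {k r} {C : Circuit k} {I v} (e : Fin r → TreeType) → GatesSM C I →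
                 Injective _≡_ _≡_ e →
                 (∀ i → ∃ λ (p : ProofTree C v) → typeAt I p ≡ e i) →
                 (∀ (p : ProofTree C v) → ∃ λ i → typeAt I p ≡ e i) →
                 ∀ m → sumFin r (λ i → part C I (e i) v m) ≈ coeffAt C v m
  sum-of-parts {r = r} {C} {I} {v} e sm injective realized covers m =
    Rg.trans (Rg.reflexive (sumFin-tabulate r e (λ σ → part C I σ v m)))
             (Rg.sym (decomposition C I sm v (enumeration-cover e sm injective realized covers) m))

mainTheorem18 : ∀ {c ℓ : Level} (F : CommutativeRing c ℓ) → IsField F →
    (d : ℕ) (nv : Fin d → ℕ) →
    let open Circuits F d nv
        open CommutativeRing F using (_≈_)
    in (C : SMCircuit) (r : ℕ) → NumProofTreeTypes C r →
       Σ (Fin r → SMCircuit) λ Cs →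
         (∀ i → size (Cs i) ≤ size C)
         × (∀ (m : Monomial) → sumFin r (λ i → coeff (Cs i) m) ≈ coeff C m)
         × (∀ i → SingleType (Cs i))
mainTheorem18 F _ d nv C r (e , e-injective , e-realized , e-covers) = Cs , (λ _ → ≤-refl) , sums , single
  where
  open Circuits F d nv
  open ProofTreeTypes F d nv
  open CircuitBasics F d nv
  open Restriction F d nv
  open Decomposition F d nv
  open CommutativeRing F using (_≈_)
  sm : GatesSM (gates C) (label C)
  sm = gatesSM (proj₁ (isSM C))
  Cs : Fin r → SMCircuit
  Cs i = record { n = n C ; gates = restrict (gates C) (label C) (e i ↾_) ; label = label C
                ; isSM = gateSM (restrict-sm (e i ↾_) sm) , proj₂ (isSM C) }
  sums : ∀ m → sumFin r (λ i → coeff (Cs i) m) ≈ coeff C m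
  sums = sum-of-parts e sm e-injective e-realized e-covers
  single : ∀ i → SingleType (Cs i)
  single i p q = trans (restrict-single (gates C) (label C) (e i ↾_) sm p)
                       (sym (restrict-single (gates C) (label C) (e i ↾_) sm q))
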